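{- Let $\Gamma$ be a $2$-$Y$-homogeneous distance-biregular graph with color classes $Y,Y'$ and $D\ge 3$. Let $i$ be an integer with $1\le i\le\min\{D-1,D'-1\}$, and assume $\gamma_2\ne 0$ and $\gamma_i\ne 0$. Then: (i) if $c_2'\ge 2$, then $(k'-2)(\gamma_2-1)=(c_2-1)(c_2'-2)$; (ii) if $i$ is even, then $\gamma_i(c_{i+1}-1)=c_i(c_2'-1)$; (iii) if $i$ is odd, then $\gamma_i(c'_{i+1}-1)=c'_i(c_2'-1)$.
   Context: All graphs are finite, simple and connected. $\Gamma_i(x)$ is the set of vertices at distance $i$ from $x$. A vertex $x$ is distance-regularized if for every $i$ the numbers $|\Gamma_{i-1}(x)\cap\Gamma_1(y)|$, $|\Gamma_i(x)\cap\Gamma_1(y)|$, $|\Gamma_{i+1}(x)\cap\Gamma_1(y)|$ depend only on $i$, not on $y\in\Gamma_i(x)$. A distance-biregular graph with color classes $Y,Y'$ is a bipartite graph with bipartition $(Y,Y')$ in which every vertex is distance-regularized, vertices in the same color class have the same intersection numbers, and vertices in different classes have different intersection arrays. $D$ (resp. $D'$) is the eccentricity and $k$ (resp. $k'$) the valency of vertices of $Y$ (resp. $Y'$). For $x\in Y$, $z\in\Gamma_i(x)$: $c_i=|\Gamma_{i-1}(x)\cap\Gamma_1(z)|$; $c_i'$ is defined the same way for $x\in Y'$. $\Gamma$ is $2$-$Y$-homogeneous if for every $i$ with $1\le i\le D-1$ there is a number $\gamma_i$ with $|\Gamma_{i-1}(z)\cap\Gamma_1(x)\cap\Gamma_1(y)|=\gamma_i$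 for all $x\in Y$, $y\in\Gamma_2(x)$, $z\in\Gamma_i(x)\cap\Gamma_i(y)$. -}

module Defs where

open import Data.Nat using (ℕ; zero; suc; _+_; _∸_; _≡ᵇ_)
open import Data.Fin using (toℕ)
open import Data.Bool using (Bool; true; false; _∧_; _∨_; not; if_then_else_)
open import Data.Fin using (Fin)
open import Data.List using (List; map)
open import Data.Nat.ListAction using (sum)
open import Data.Bool.ListAction using (any)
open import Data.List using () renaming (allFin to allFinL)
open import Data.Product using (Σ; ∃; ∃-syntax; _×_)
open import Relation.Binary.PropositionalEquality using (_≡_; _≢_)
open import Relation.Nullary using (¬_)

record Graph : Set where
  field
    n     : ℕ
    adj   : Fin n → Fin n → Bool
    sym   : ∀ x y → adj x y ≡ adj y x
    irrefl : ∀ x → adj x x ≡ false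

module _ (G : Graph) where
  open Graph G

  vertices : List (Fin n)
  vertices = allFinL n

  count : (Fin n → Bool) → ℕ
  count P = sum (map (λ z → if P z then 1 else 0) vertices)

  eqB : Fin n → Fin n → Bool
  eqB x y = toℕ x ≡ᵇ toℕ y

  within : ℕ → Fin n → Fin n → Bool
  within zero    x y = eqB x y
  within (suc d) x y = within d x y ∨ any (λ z → within d x z ∧ adj z y) vertices

  atDist : ℕ → Fin n → Fin n → Bool
  atDist zero    x y = within zero x y
  atDist (suc d) x y = within (suc d) x y ∧ not (within d x y)

  Connected : Set
  Connected = ∀ x y → ∃[ d ] (atDist d x y ≡ true)

  degree : Fin n → ℕ
  degree x = count (adj x)

  Ecc : Fin n → ℕ → Set
  Ecc x e = (∀ y → within e x y ≡ true) × (∃[ y ] (atDist e x y ≡ true))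

  -- |Γ_{i-1}(x) ∩ Γ_1(y)|, |Γ_i(x) ∩ Γ_1(y)|, |Γ_{i+1}(x) ∩ Γ_1(y)|
  -- (for i = 0, y = x and Γ_{i-1}(x) is read as Γ_0(x) = {x}; the count is 0 as intended)
  cNum : ℕ → Fin n → Fin n → ℕ
  cNum i x y = count (λ w → atDist (i ∸ 1) x w ∧ adj y w)
  aNum : ℕ → Fin n → Fin n → ℕ
  aNum i x y = count (λ w → atDist i x w ∧ adj y w)
  bNum : ℕ → Fin n → Fin n → ℕ
  bNum i x y = count (λ w → atDist (suc i) x w ∧ adj y w)

  DistanceRegularized : Fin n → Set
  DistanceRegularized x = ∀ i y y' → atDist i x y ≡ true → atDist i x y' ≡ true →
    (cNum i x y ≡ cNum i x y') × (aNum i x y ≡ aNum i x y') × (bNum i x y ≡ bNum i x y')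

  -- distance-regularized vertices x, x' have the same intersection array
  -- (same eccentricity is forced: b_i vanishes exactly at i = eccentricity, by connectivity)
  SameArray : Fin n → Fin n → Set
  SameArray x x' = ∀ i y y' → atDist i x y ≡ true → atDist i x' y' ≡ true →
    (cNum i x y ≡ cNum i x' y') × (aNum i x y ≡ aNum i x' y') × (bNum i x y ≡ bNum i x' y')

  -- Γ is a distance-biregular graph with colour classes Y = {x | col x ≡ true},
  -- Y' = {x | col x ≡ false}
  record DistanceBiregular (col : Fin n → Bool) : Set where
    field
      connected   : Connected
      bipartite   : ∀ x y → adj x y ≡ true → col x ≢ col y
      Y-nonempty  : ∃[ x ] (col x ≡ true)
      Y'-nonempty : ∃[ x ] (col x ≡ false)
      regularized : ∀ x → DistanceRegularized x
      sameClass   : ∀ x x' → col x ≡ col x' → SameArray x x'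
      diffClass   : ∀ x x' → col x ≡ true → col x' ≡ false → ¬ SameArray x x'

{-# OPTIONS --safe #-}
-- Both identities are double counts of pairs (vertex, vertex) in a bipartite graph.
-- (i) Fix x ∈ Y, y ∈ Γ₂(x) and a common neighbour w.  Pairs (z, u) with
-- z ∈ Γ(w) ∖ {x, y} and u ∈ Γ(z) ∩ Γ(x) ∩ Γ(y) ∖ {w} number (k' − 2)(γ₂ − 1) counted
-- by z, and (c₂ − 1)(c'₂ − 2) counted by u, since then u ∈ Γ₂(w).
-- (ii), (iii) Fix z, w ∈ Γ_{i+1}(z) and x ∈ Γ_i(z) ∩ Γ(w) ∩ Y.  Pairs (y, u) with
-- y ∈ Γ_i(z) ∩ Γ(w) ∖ {x} and u ∈ Γ_{i−1}(z) ∩ Γ(x) ∩ Γ(y) number γ_i (c_{i+1} − 1)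
-- counted by y, and c_i (c'₂ − 1) counted by u, since then u ∈ Γ₂(w) and every
-- y ∈ Γ(w) ∩ Γ(u) lies in Γ_i(z).  Taking z ∈ Y for even i and z ∈ Y' for odd i makes x ∈ Y.
module Submission where

open import Defs

open import Data.Bool using (Bool; true; false; _∧_; _∨_; not; if_then_else_)
open import Data.Bool.Properties
  using (∧-zeroʳ; ∨-zeroʳ; not-¬; ¬-not; T-≡; ⇔→≡; ∧-commutativeMonoid)
open import Data.Bool.ListAction using (any)
open import Data.Fin using (Fin; zero; suc; toℕ)
open import Data.Fin.Properties using (toℕ-injective)
open import Data.List using (map; tabulate)
open import Data.List.Membership.Propositional using (lose)
open import Data.List.Membership.Propositional.Properties using (∈-allFin)
open import Data.List.Relation.Unary.Any using (satisfied)
open import Data.List.Relation.Unary.Any.Properties using (any⁺; any⁻)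
open import Data.Nat using (ℕ; zero; suc; _+_; _∸_; _≤_; _⊓_; _≡ᵇ_; z≤n; s≤s)
open import Data.Nat.Divisibility using (_∣_; _∤_; ∣-refl; _∣0; ∣1⇒≡1; ∣m+n∣m⇒∣n; ∣m∣n⇒∣m+n)
import Data.Nat as ℕ
import Data.Nat.ListAction as List
open import Data.Nat.Properties
  using ( +-0-commutativeMonoid; +-*-semiring; *-identityʳ; *-zeroʳ; *-comm; ∸-+-assoc
        ; ∸-monoˡ-≤; <⇒≤; n≢0⇒n>0; m≤n⇒m<n∨m≡n; m≤n⊓o⇒m≤n; m≤n⊓o⇒m≤o; ≡ᵇ⇒≡; ≡⇒≡ᵇ)
open import Data.Product using (∃-syntax; _×_; _,_; proj₁; proj₂; map₂)
open import Data.Sum using (_⊎_; inj₁; inj₂)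
open import Function using (_∘_; Equivalence; mk⇔)
open import Relation.Binary.PropositionalEquality
open import Relation.Nullary using (¬_; contradiction)

open import Algebra.Properties.CommutativeMonoid.Sum +-0-commutativeMonoid
  using (sum-syntax; sum-cong-≗; sum-replicate-zero; ∑-distrib-+; ∑-comm)
open import Algebra.Properties.Semiring.Sum +-*-semiring using (*-distribˡ-sum)
open import Algebra.Solver.CommutativeMonoid ∧-commutativeMonoid using (solve; _⊕_; _⊜_)

open ≡-Reasoning

private
  variable
    a b : Bool
    e m n' : ℕ

∧-true⁻ : a ∧ b ≡ true → a ≡ true × b ≡ true
∧-true⁻ {true} ab = refl , ab

∨-true⁻ : a ∨ b ≡ true → a ≡ true ⊎ b ≡ true
∨-true⁻ {true}  _  = inj₁ refl
∨-true⁻ {false} ab = inj₂ ab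

∧-implied : (b ≡ true → a ≡ true) → a ∧ b ≡ b
∧-implied {b = false} _ = ∧-zeroʳ _
∧-implied {b = true}  h = cong (_∧ true) (h refl)

m<n∸1⇒1+m<n : ∀ n → suc m ≤ n ∸ 1 → suc (suc m) ≤ n
m<n∸1⇒1+m<n (suc n) m<n∸1 = s≤s m<n∸1

indicator : Bool → ℕ
indicator b = if b then 1 else 0

sum-map-tabulate : ∀ {A : Set} {k} (f : A → ℕ) (g : Fin k → A) →
  List.sum (map f (tabulate g)) ≡ ∑[ i < k ] f (g i)
sum-map-tabulate {k = zero}  f g = refl
sum-map-tabulate {k = suc k} f g = cong (f (g zero) +_) (sum-map-tabulate f (g ∘ suc))

∑-indicator-≡ᵇ : ∀ {k} (x : Fin k) → ∑[ z < k ] indicator (toℕ x ≡ᵇ toℕ z) ≡ 1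
∑-indicator-≡ᵇ {suc k} zero    = cong suc (sum-replicate-zero k)
∑-indicator-≡ᵇ {suc k} (suc x) = ∑-indicator-≡ᵇ x

module Counting (G : Graph) where
  open Graph G using (n)
  open import Data.Nat using (_*_)

  private
    variable
      x y : Fin n
      P Q : Fin n → Bool

  eqB-refl : ∀ x → eqB G x x ≡ true
  eqB-refl x = Equivalence.to T-≡ (≡⇒≡ᵇ (toℕ x) (toℕ x) refl)

  eqB⇒≡ : eqB G x y ≡ true → x ≡ y
  eqB⇒≡ {x} {y} xy = toℕ-injective (≡ᵇ⇒≡ (toℕ x) (toℕ y) (Equivalence.from T-≡ xy))

  infixl 5 _∖_
  _∖_ : (Fin n → Bool) → Fin n → Fin n → Bool
  (P ∖ x) z = P z ∧ not (eqB G x z)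

  ∖-true : ∀ P x {y} → P y ≡ true → x ≢ y → (P ∖ x) y ≡ true
  ∖-true P x Py x≢y = cong₂ _∧_ Py (cong not (¬-not (x≢y ∘ eqB⇒≡)))

  ∖-true⁻ : ∀ P x {y} → (P ∖ x) y ≡ true → P y ≡ true × x ≢ y
  ∖-true⁻ P x Py∖x =
    let Py , x≠y = ∧-true⁻ Py∖x in Py , λ { refl → not-¬ refl (trans (eqB-refl x) (sym x≠y)) }

  count≡∑ : ∀ P → count G P ≡ ∑[ z < n ] indicator (P z)
  count≡∑ P = sum-map-tabulate (indicator ∘ P) (λ z → z)

  count-cong : (∀ z → P z ≡ Q z) → count G P ≡ count G Q
  count-cong {P} {Q} P≗Q = begin
    count G P                     ≡⟨ count≡∑ P ⟩
    ∑[ z < n ] indicator (P z)    ≡⟨ sum-cong-≗ (cong indicator ∘ P≗Q) ⟩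
    ∑[ z < n ] indicator (Q z)    ≡⟨ count≡∑ Q ⟨
    count G Q                     ∎

  count-remove : ∀ P {x} → P x ≡ true → count G P ≡ suc (count G (P ∖ x))
  count-remove P {x} Px = begin
    count G P
      ≡⟨ count≡∑ P ⟩
    ∑[ z < n ] indicator (P z)
      ≡⟨ sum-cong-≗ split ⟩
    ∑[ z < n ] (indicator (eqB G x z) + indicator ((P ∖ x) z))
      ≡⟨ ∑-distrib-+ (indicator ∘ eqB G x) (indicator ∘ (P ∖ x)) ⟩
    ∑[ z < n ] indicator (eqB G x z) + ∑[ z < n ] indicator ((P ∖ x) z)
      ≡⟨ cong₂ _+_ (∑-indicator-≡ᵇ x) (sym (count≡∑ (P ∖ x))) ⟩
    suc (count G (P ∖ x))
      ∎
    where
    split : ∀ z → indicator (P z) ≡ indicator (eqB G x z) + indicator ((P ∖ x) z)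
    split z with eqB G x z in x≡z | P z in Pz
    ... | false | false = refl
    ... | false | true  = refl
    ... | true  | true  = refl
    ... | true  | false with () ← trans (sym Px) (trans (cong P (eqB⇒≡ x≡z)) Pz)

  count-∖ : ∀ P {x} → P x ≡ true → count G (P ∖ x) ≡ count G P ∸ 1
  count-∖ P Px = cong (_∸ 1) (sym (count-remove P Px))

  count-∖∖ : ∀ P {x y} → P x ≡ true → P y ≡ true → x ≢ y → count G (P ∖ x ∖ y) ≡ count G P ∸ 2
  count-∖∖ P {x} {y} Px Py x≢y = begin
    count G (P ∖ x ∖ y)    ≡⟨ count-∖ (P ∖ x) (∖-true P x Py x≢y) ⟩
    count G (P ∖ x) ∸ 1    ≡⟨ cong (_∸ 1) (count-∖ P Px) ⟩
    count G P ∸ 1 ∸ 1      ≡⟨ ∸-+-assoc (count G P) 1 1 ⟩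
    count G P ∸ 2          ∎

  count-pos : ∀ P {x} → P x ≡ true → 1 ≤ count G P
  count-pos P Px = subst (1 ≤_) (sym (count-remove P Px)) (s≤s z≤n)

  count-≥2 : ∀ P {x y} → P x ≡ true → P y ≡ true → x ≢ y → 2 ≤ count G P
  count-≥2 P {x} Px Py x≢y =
    subst (2 ≤_) (sym (count-remove P Px)) (s≤s (count-pos (P ∖ x) (∖-true P x Py x≢y)))

  ∑-count-∧ : ∀ (A : Fin n → Bool) (B : Fin n → Fin n → Bool) g →
    (∀ z → A z ≡ true → count G (B z) ≡ g) →
    ∑[ z < n ] count G (λ u → A z ∧ B z u) ≡ g * count G A
  ∑-count-∧ A B g B-count = begin
    ∑[ z < n ] count G (λ u → A z ∧ B z u)  ≡⟨ sum-cong-≗ term ⟩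
    ∑[ z < n ] (g * indicator (A z))        ≡⟨ *-distribˡ-sum g (indicator ∘ A) ⟨
    g * ∑[ z < n ] indicator (A z)          ≡⟨ cong (g *_) (count≡∑ A) ⟨
    g * count G A                           ∎
    where
    term : ∀ z → count G (λ u → A z ∧ B z u) ≡ g * indicator (A z)
    term z with A z in Az
    ... | true  = trans (B-count z Az) (sym (*-identityʳ g))
    ... | false = trans (count≡∑ _) (trans (sum-replicate-zero n) (sym (*-zeroʳ g)))

  double-count : ∀ (A C : Fin n → Bool) (B E : Fin n → Fin n → Bool) {g h} →
    (∀ z u → (A z ∧ B z u) ≡ (C u ∧ E u z)) →
    (∀ z → A z ≡ true → count G (B z) ≡ g) →
    (∀ u → C u ≡ true → count G (E u) ≡ h) →
    g * count G A ≡ h * count G C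
  double-count A C B E {g} {h} AB≡CE B-count E-count = begin
    g * count G A
      ≡⟨ ∑-count-∧ A B g B-count ⟨
    ∑[ z < n ] count G (λ u → A z ∧ B z u)
      ≡⟨ sum-cong-≗ (λ z → count≡∑ (λ u → A z ∧ B z u)) ⟩
    ∑[ z < n ] ∑[ u < n ] indicator (A z ∧ B z u)
      ≡⟨ sum-cong-≗ (λ z → sum-cong-≗ (cong indicator ∘ AB≡CE z)) ⟩
    ∑[ z < n ] ∑[ u < n ] indicator (C u ∧ E u z)
      ≡⟨ ∑-comm (λ z u → indicator (C u ∧ E u z)) ⟩
    ∑[ u < n ] ∑[ z < n ] indicator (C u ∧ E u z)
      ≡⟨ sum-cong-≗ (λ u → count≡∑ (λ z → C u ∧ E u z)) ⟨
    ∑[ u < n ] count G (λ z → C u ∧ E u z)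
      ≡⟨ ∑-count-∧ C E h E-count ⟩
    h * count G C
      ∎

module Distance (G : Graph) where
  open Graph G using (n; adj; irrefl) renaming (sym to adj-sym)
  open Counting G using (eqB-refl; eqB⇒≡; count-pos)

  private
    variable
      w x y : Fin n

  any-vertices⁻ : ∀ p → any p (vertices G) ≡ true → ∃[ z ] p z ≡ true
  any-vertices⁻ p anyp =
    map₂ (Equivalence.to T-≡) (satisfied (any⁻ p (vertices G) (Equivalence.from T-≡ anyp)))

  any-vertices⁺ : ∀ p z → p z ≡ true → any p (vertices G) ≡ true
  any-vertices⁺ p z pz = Equivalence.to T-≡ (any⁺ p (lose (∈-allFin z) (Equivalence.from T-≡ pz)))

  adj⇒≢ : adj x y ≡ true → x ≢ y
  adj⇒≢ {x} xx refl with () ← trans (sym xx) (irrefl x)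

  within-zero⇒≡ : ∀ x y → within G 0 x y ≡ true → x ≡ y
  within-zero⇒≡ x y = eqB⇒≡ {x} {y}

  within-suc : ∀ d {x y} → within G d x y ≡ true → within G (suc d) x y ≡ true
  within-suc d {x} {y} xy = cong (_∨ any (λ z → within G d x z ∧ adj z y) (vertices G)) xy

  within-step : ∀ d {x y v} → within G d x y ≡ true → adj y v ≡ true → within G (suc d) x v ≡ true
  within-step d {x} {y} {v} xy yv =
    trans (cong (within G d x v ∨_) (any-vertices⁺ _ y (cong₂ _∧_ xy yv))) (∨-zeroʳ _)

  within-suc⁻ : ∀ d {x y} → within G (suc d) x y ≡ true →
    within G d x y ≡ true ⊎ ∃[ u ] (within G d x u ≡ true × adj u y ≡ true)
  within-suc⁻ d {x} {y} xy with ∨-true⁻ {within G d x y} xy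
  ... | inj₁ xy′ = inj₁ xy′
  ... | inj₂ ∃u  = inj₂ (map₂ ∧-true⁻ (any-vertices⁻ (λ u → within G d x u ∧ adj u y) ∃u))

  within-1⁻ : ∀ x y → within G 1 x y ≡ true → x ≡ y ⊎ adj x y ≡ true
  within-1⁻ x y xy with within-suc⁻ 0 {x} {y} xy
  ... | inj₁ x≡y            = inj₁ (within-zero⇒≡ x y x≡y)
  ... | inj₂ (u , x≡u , uy) = inj₂ (subst (λ t → adj t y ≡ true) (sym (within-zero⇒≡ x u x≡u)) uy)

  within-prepend : ∀ d {x z y} → adj x z ≡ true → within G d z y ≡ true → within G (suc d) x y ≡ true
  within-prepend zero {x} {z} {y} xz zy =
    within-step 0 {x} (eqB-refl x) (subst (λ t → adj x t ≡ true) (within-zero⇒≡ z y zy) xz)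
  within-prepend (suc d) xz zy with within-suc⁻ d zy
  ... | inj₁ zy′          = within-suc (suc d) (within-prepend d xz zy′)
  ... | inj₂ (u , zu , uy) = within-step (suc d) (within-prepend d xz zu) uy

  within-sym : ∀ d {x y} → within G d x y ≡ true → within G d y x ≡ true
  within-sym zero {x} {y} xy rewrite within-zero⇒≡ x y xy = eqB-refl y
  within-sym (suc d) {x} {y} xy with within-suc⁻ d xy
  ... | inj₁ xy′          = within-suc d (within-sym d xy′)
  ... | inj₂ (u , xu , uy) = within-prepend d (trans (adj-sym y u) uy) (within-sym d xu)

  atDist⇒within : ∀ d {x y} → atDist G d x y ≡ true → within G d x y ≡ true
  atDist⇒within zero    xy = xy
  atDist⇒within (suc d) xy = proj₁ (∧-true⁻ xy)

  atDist-suc⇒¬within : ∀ d {x y} → atDist G (suc d) x y ≡ true → within G d x y ≢ true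
  atDist-suc⇒¬within d {x} {y} xy within-d
    with () ← trans (cong not (sym within-d)) (proj₂ (∧-true⁻ {within G (suc d) x y} xy))

  atDist-intro : ∀ d {x y} → within G (suc d) x y ≡ true → within G d x y ≢ true →
    atDist G (suc d) x y ≡ true
  atDist-intro d within-d+1 ¬within-d = cong₂ _∧_ within-d+1 (cong not (¬-not ¬within-d))

  atDist-sym : ∀ d {x y} → atDist G d x y ≡ true → atDist G d y x ≡ true
  atDist-sym zero {x} {y} xy = within-sym zero {x} {y} xy
  atDist-sym (suc d) xy =
    atDist-intro d (within-sym (suc d) (atDist⇒within (suc d) xy))
      (atDist-suc⇒¬within d xy ∘ within-sym d)

  atDist-≢ : ∀ j {z u w} → atDist G j z u ≡ true → atDist G (suc (suc j)) z w ≡ true → u ≢ w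
  atDist-≢ j zu zw refl = atDist-suc⇒¬within (suc j) zw (within-suc j (atDist⇒within j zu))

  atDist-between : ∀ j {z u y w} → atDist G j z u ≡ true → adj u y ≡ true →
    atDist G (suc (suc j)) z w ≡ true → adj y w ≡ true → atDist G (suc j) z y ≡ true
  atDist-between j zu uy zw yw =
    atDist-intro j (within-step j (atDist⇒within j zu) uy)
      (λ zy → atDist-suc⇒¬within (suc j) zw (within-step j zy yw))

  atDist-of-neighbour : ∀ d {z u v} → atDist G (suc d) z v ≡ true → within G d z u ≡ true →
    adj u v ≡ true → atDist G d z u ≡ true
  atDist-of-neighbour zero    _  zu _  = zu
  atDist-of-neighbour (suc d) zv zu uv =
    atDist-intro d zu (λ zu′ → atDist-suc⇒¬within (suc d) zv (within-step d zu′ uv))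

  atDist-pred : ∀ d {z v} → atDist G (suc d) z v ≡ true →
    ∃[ u ] (atDist G d z u ≡ true × adj u v ≡ true)
  atDist-pred d zv with within-suc⁻ d (atDist⇒within (suc d) zv)
  ... | inj₁ zv′          = contradiction zv′ (atDist-suc⇒¬within d zv)
  ... | inj₂ (u , zu , uv) = u , atDist-of-neighbour d zv zu uv , uv

  cNum-pos : ∀ d {x z} → atDist G (suc d) x z ≡ true → 1 ≤ cNum G (suc d) x z
  cNum-pos d {z = z} xz =
    let u , xu , uz = atDist-pred d xz in count-pos _ (cong₂ _∧_ xu (trans (adj-sym z u) uz))

  atDist-below : ∀ e {z y} → atDist G e z y ≡ true → m ≤ e → ∃[ v ] atDist G m z v ≡ true
  atDist-below e zy m≤e with m≤n⇒m<n∨m≡n m≤e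
  ... | inj₂ refl = _ , zy
  atDist-below (suc e) zy _ | inj₁ (s≤s m≤e) =
    atDist-below e (proj₁ (proj₂ (atDist-pred e zy))) m≤e

  Ecc⇒atDist : Ecc G x e → m ≤ e → ∃[ y ] atDist G m x y ≡ true
  Ecc⇒atDist {e = e} (_ , _ , xy) = atDist-below e xy

  atDist-1 : ∀ x y → atDist G 1 x y ≡ adj x y
  atDist-1 x y = ⇔→≡ (mk⇔ to from)
    where
    to : atDist G 1 x y ≡ true → adj x y ≡ true
    to xy with within-1⁻ x y (atDist⇒within 1 {x} {y} xy)
    ... | inj₁ refl   = contradiction (eqB-refl x) (atDist-suc⇒¬within 0 {x} {x} xy)
    ... | inj₂ adj-xy = adj-xy
    from : adj x y ≡ true → atDist G 1 x y ≡ true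
    from xy =
      atDist-intro 0 {x} {y} (within-step 0 {x} (eqB-refl x) xy) (adj⇒≢ xy ∘ within-zero⇒≡ x y)

  atDist-2 : adj x w ≡ true → adj w y ≡ true → x ≢ y → adj x y ≢ true → atDist G 2 x y ≡ true
  atDist-2 {x} {w} {y} xw wy x≢y ¬xy =
    atDist-intro 1 {x} {y} (within-step 1 {x} (within-step 0 {x} (eqB-refl x) xw) wy) ¬within-1
    where
    ¬within-1 : within G 1 x y ≢ true
    ¬within-1 xy with within-1⁻ x y xy
    ... | inj₁ x≡y    = x≢y x≡y
    ... | inj₂ adj-xy = ¬xy adj-xy

module Bipartite (G : Graph) (col : Fin (Graph.n G) → Bool)
                 (bipartite : ∀ x y → Graph.adj G x y ≡ true → col x ≢ col y) where
  open Graph G using (n; adj) renaming (sym to adj-sym)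
  open import Data.Nat using (_*_)
  open Counting G
  open Distance G

  private
    variable
      w x y z : Fin n
      γ c' : ℕ

  adj⇒col-not : adj x y ≡ true → col y ≡ not (col x)
  adj⇒col-not {x} {y} xy = ¬-not (bipartite x y xy ∘ sym)

  col-neighbours : adj x y ≡ true → adj x z ≡ true → col y ≡ col z
  col-neighbours xy xz = trans (adj⇒col-not xy) (sym (adj⇒col-not xz))

  atDist-2-path : adj x w ≡ true → adj w y ≡ true → x ≢ y → atDist G 2 x y ≡ true
  atDist-2-path {x} {w} {y} xw wy x≢y =
    atDist-2 xw wy x≢y (λ xy → bipartite x y xy (col-neighbours (trans (adj-sym w x) xw) wy))

  atDist-suc-suc-colour : ∀ d {z x} → atDist G (suc (suc d)) z x ≡ true →
    ∃[ u ] (atDist G d z u ≡ true × col u ≡ col x)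
  atDist-suc-suc-colour d zx =
    let v , zv , vx = atDist-pred (suc d) zx
        u , zu , uv = atDist-pred d zv
    in u , zu , col-neighbours (trans (adj-sym v u) uv) vx

  atDist-even-colour : ∀ d {z x} → 2 ∣ d → atDist G d z x ≡ true → col x ≡ col z
  atDist-even-colour zero {z} {x} _ zx = cong col (sym (within-zero⇒≡ z x zx))
  atDist-even-colour (suc zero) 2∣1 _ with () ← ∣1⇒≡1 2∣1
  atDist-even-colour (suc (suc d)) 2∣d+2 zx =
    let u , zu , u~x = atDist-suc-suc-colour d zx
    in trans (sym u~x) (atDist-even-colour d (∣m+n∣m⇒∣n 2∣d+2 ∣-refl) zu)

  atDist-odd-colour : ∀ d {z x} → 2 ∤ d → atDist G d z x ≡ true → col x ≢ col z
  atDist-odd-colour zero 2∤0 _ = contradiction (2 ∣0) 2∤0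
  atDist-odd-colour (suc zero) {z} _ zx with atDist-pred 0 {z} zx
  ... | u , z≡u , ux rewrite within-zero⇒≡ z u z≡u = bipartite u _ ux ∘ sym
  atDist-odd-colour (suc (suc d)) 2∤d+2 zx =
    let u , zu , u~x = atDist-suc-suc-colour d zx
    in atDist-odd-colour d (2∤d+2 ∘ ∣m∣n⇒∣m+n ∣-refl) zu ∘ trans u~x

  common-neighbour-count : adj x w ≡ true → adj w y ≡ true → x ≢ y →
    (∀ z → atDist G 2 x z ≡ true → atDist G 2 y z ≡ true →
       count G (λ u → atDist G 1 z u ∧ adj x u ∧ adj y u) ≡ γ) →
    (∀ u → atDist G 2 w u ≡ true → cNum G 2 w u ≡ c') →
    (γ ∸ 1) * (degree G w ∸ 2) ≡ (c' ∸ 2) * (cNum G 2 x y ∸ 1)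
  common-neighbour-count {x} {w} {y} {γ} {c'} xw wy x≢y γ-count c'-count = begin
    (γ ∸ 1) * (degree G w ∸ 2)
      ≡⟨ cong ((γ ∸ 1) *_) (count-∖∖ (adj w) wx wy x≢y) ⟨
    (γ ∸ 1) * count G A
      ≡⟨ double-count A C B E AB≡CE B-count E-count ⟩
    (c' ∸ 2) * count G C
      ≡⟨ cong ((c' ∸ 2) *_) (count-∖ x∼u∼y (cong₂ _∧_ (trans (atDist-1 x w) xw) yw)) ⟩
    (c' ∸ 2) * (cNum G 2 x y ∸ 1)
      ∎
    where
    wx = trans (adj-sym w x) xw
    yw = trans (adj-sym y w) wy
    x∼u∼y : Fin n → Bool
    x∼u∼y u = atDist G 1 x u ∧ adj y u
    A : Fin n → Bool
    A = adj w ∖ x ∖ y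
    B : Fin n → Fin n → Bool
    B z = (λ u → atDist G 1 z u ∧ adj x u ∧ adj y u) ∖ w
    C : Fin n → Bool
    C = x∼u∼y ∖ w
    E : Fin n → Fin n → Bool
    E u = (λ z → adj w z ∧ adj u z) ∖ x ∖ y

    B-count : ∀ z → A z ≡ true → count G (B z) ≡ γ ∸ 1
    B-count z Az =
      let A′z , y≢z = ∖-true⁻ (adj w ∖ x) y Az
          wz , x≢z  = ∖-true⁻ (adj w) x A′z
          zw        = trans (atDist-1 z w) (trans (adj-sym z w) wz)
      in begin
        count G (B z)
          ≡⟨ count-∖ _ (cong₂ _∧_ zw (cong₂ _∧_ xw yw)) ⟩
        count G (λ u → atDist G 1 z u ∧ adj x u ∧ adj y u) ∸ 1
          ≡⟨ cong (_∸ 1) (γ-count z (atDist-2-path xw wz x≢z) (atDist-2-path yw wz y≢z)) ⟩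
        γ ∸ 1
          ∎

    E-count : ∀ u → C u ≡ true → count G (E u) ≡ c' ∸ 2
    E-count u Cu =
      let x∼u∼y-u , w≢u = ∖-true⁻ x∼u∼y w Cu
          x∼u , yu      = ∧-true⁻ x∼u∼y-u
          xu            = trans (sym (atDist-1 x u)) x∼u
          ux            = trans (adj-sym u x) xu
          uy            = trans (adj-sym u y) yu
      in begin
        count G (E u)
          ≡⟨ count-∖∖ _ (cong₂ _∧_ wx ux) (cong₂ _∧_ wy uy) x≢y ⟩
        count G (λ z → adj w z ∧ adj u z) ∸ 2
          ≡⟨ cong (_∸ 2) (count-cong (λ z → cong (_∧ adj u z) (atDist-1 w z))) ⟨
        cNum G 2 w u ∸ 2
          ≡⟨ cong (_∸ 2) (c'-count u (atDist-2-path wx xu w≢u)) ⟩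
        c' ∸ 2
          ∎

    AB≡CE : ∀ z u → (A z ∧ B z u) ≡ (C u ∧ E u z)
    AB≡CE z u rewrite atDist-1 z u | atDist-1 x u | adj-sym u z =
      solve 7 (λ wz x≠z y≠z zu xu yu w≠u →
                 ((wz ⊕ x≠z) ⊕ y≠z) ⊕ ((zu ⊕ (xu ⊕ yu)) ⊕ w≠u)
               ⊜ ((xu ⊕ yu) ⊕ w≠u) ⊕ (((wz ⊕ zu) ⊕ x≠z) ⊕ y≠z))
        refl (adj w z) _ _ (adj z u) (adj x u) (adj y u) _

  atDist-2-across : ∀ j {z u x w} → atDist G j z u ≡ true → adj x u ≡ true → adj x w ≡ true →
    atDist G (suc (suc j)) z w ≡ true → atDist G 2 w u ≡ true
  atDist-2-across j {x = x} {w} zu xu xw zw =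
    atDist-2-path (trans (adj-sym w x) xw) xu (atDist-≢ j zu zw ∘ sym)

  geodesic-count : ∀ j {z x w} → atDist G (suc j) z x ≡ true → adj x w ≡ true →
    atDist G (suc (suc j)) z w ≡ true →
    (∀ y → atDist G 2 x y ≡ true → atDist G (suc j) z y ≡ true →
       count G (λ u → atDist G j z u ∧ adj x u ∧ adj y u) ≡ γ) →
    (∀ u → atDist G 2 w u ≡ true → cNum G 2 w u ≡ c') →
    γ * (cNum G (suc (suc j)) z w ∸ 1) ≡ (c' ∸ 1) * cNum G (suc j) z x
  geodesic-count {γ = γ} {c' = c'} j {z} {x} {w} zx xw zw γ-count c'-count = begin
    γ * (cNum G (suc (suc j)) z w ∸ 1)
      ≡⟨ cong (γ *_) (count-∖ z∼y∼w (cong₂ _∧_ zx wx)) ⟨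
    γ * count G A
      ≡⟨ double-count A C B E AB≡CE B-count E-count ⟩
    (c' ∸ 1) * cNum G (suc j) z x
      ∎
    where
    wx = trans (adj-sym w x) xw
    z∼y∼w : Fin n → Bool
    z∼y∼w y = atDist G (suc j) z y ∧ adj w y
    A : Fin n → Bool
    A = z∼y∼w ∖ x
    B : Fin n → Fin n → Bool
    B y u = atDist G j z u ∧ adj x u ∧ adj y u
    C : Fin n → Bool
    C u = atDist G j z u ∧ adj x u
    -- The conjunct atDist G (suc j) z y is implied by the other two (see on-geodesic);
    -- keeping it makes AB≡CE a mere rearrangement of conjuncts.
    E : Fin n → Fin n → Bool
    E u = (λ y → atDist G (suc j) z y ∧ adj w y ∧ adj u y) ∖ x

    B-count : ∀ y → A y ≡ true → count G (B y) ≡ γ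
    B-count y Ay =
      let z∼y∼w-y , x≢y = ∖-true⁻ z∼y∼w x Ay
          zy , wy       = ∧-true⁻ z∼y∼w-y
      in γ-count y (atDist-2-path xw wy x≢y) zy

    E-count : ∀ u → C u ≡ true → count G (E u) ≡ c' ∸ 1
    E-count u Cu = begin
      count G (E u)
        ≡⟨ count-∖ _ (cong₂ _∧_ zx (cong₂ _∧_ wx (trans (adj-sym u x) xu))) ⟩
      count G (λ y → atDist G (suc j) z y ∧ adj w y ∧ adj u y) ∸ 1
        ≡⟨ cong (_∸ 1) (count-cong on-geodesic) ⟩
      cNum G 2 w u ∸ 1
        ≡⟨ cong (_∸ 1) (c'-count u (atDist-2-across j zu xu xw zw)) ⟩
      c' ∸ 1
        ∎
      where
      zu = proj₁ (∧-true⁻ Cu)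
      xu = proj₂ (∧-true⁻ Cu)
      on-geodesic : ∀ y → (atDist G (suc j) z y ∧ adj w y ∧ adj u y) ≡ (atDist G 1 w y ∧ adj u y)
      on-geodesic y = trans (∧-implied (λ wuy → let wy , uy = ∧-true⁻ wuy in
                                         atDist-between j zu uy zw (trans (adj-sym y w) wy)))
                            (cong (_∧ adj u y) (sym (atDist-1 w y)))

    AB≡CE : ∀ y u → (A y ∧ B y u) ≡ (C u ∧ E u y)
    AB≡CE y u rewrite adj-sym y u =
      solve 6 (λ zy wy x≠y zu xu uy →
                 ((zy ⊕ wy) ⊕ x≠y) ⊕ (zu ⊕ (xu ⊕ uy))
               ⊜ (zu ⊕ xu) ⊕ ((zy ⊕ (wy ⊕ uy)) ⊕ x≠y))
        refl (atDist G (suc j) z y) (adj w y) _ (atDist G j z u) (adj x u) (adj u y)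

-- Imported only here: the modules above use ℕ's _*_, which this one would make ambiguous.
open import Data.Integer using (+_; _-_; _*_)
open import Data.Integer.Properties using ([+m]-[+n]≡m⊖n; ⊖-≥; pos-*)

+[m∸n]≡+m-+n : n' ≤ m → + (m ∸ n') ≡ + m - + n'
+[m∸n]≡+m-+n {n'} {m} n≤m = sym (trans ([+m]-[+n]≡m⊖n m n') (⊖-≥ n≤m))

module TwoYHomogeneous
  (G : Graph) (col : Fin (Graph.n G) → Bool) (DB : DistanceBiregular G col) (D : ℕ) (c c' γ : ℕ → ℕ)
  (c-def : ∀ i x z → col x ≡ true → atDist G (suc i) x z ≡ true → cNum G (suc i) x z ≡ c (suc i))
  (c'-def : ∀ i x z → col x ≡ false → atDist G (suc i) x z ≡ true → cNum G (suc i) x z ≡ c' (suc i))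
  (γ-def : ∀ i x y z → 1 ≤ i → i ≤ D ∸ 1 → col x ≡ true → atDist G 2 x y ≡ true →
    atDist G i x z ≡ true → atDist G i y z ≡ true →
    count G (λ w → atDist G (i ∸ 1) z w ∧ Graph.adj G x w ∧ Graph.adj G y w) ≡ γ i)
  where
  open Graph G using (n; adj) renaming (sym to adj-sym)
  open DistanceBiregular DB using (bipartite)
  open Counting G using (eqB-refl; count-≥2)
  open Distance G
  open Bipartite G col bipartite

  identity-i : ∀ {x y k'} → col x ≡ true → atDist G 2 x y ≡ true → 2 ≤ D ∸ 1 →
    (∀ w → col w ≡ false → degree G w ≡ k') → γ 2 ≢ 0 → 2 ≤ c' 2 →
    (+ k' - + 2) * (+ γ 2 - + 1) ≡ (+ c 2 - + 1) * (+ c' 2 - + 2)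
  identity-i {x} {y} {k'} x∈Y xy 2≤D-1 deg' γ₂≢0 2≤c'₂ with atDist-pred 1 {x} xy
  ... | w , x∼w , wy = begin
    (+ k' - + 2) * (+ γ 2 - + 1)
      ≡⟨ cong₂ _*_ (+[m∸n]≡+m-+n 2≤k') (+[m∸n]≡+m-+n (n≢0⇒n>0 γ₂≢0)) ⟨
    + (k' ∸ 2) * + (γ 2 ∸ 1)
      ≡⟨ pos-* (k' ∸ 2) (γ 2 ∸ 1) ⟨
    + ((k' ∸ 2) ℕ.* (γ 2 ∸ 1))
      ≡⟨ cong +_ counted ⟩
    + ((c 2 ∸ 1) ℕ.* (c' 2 ∸ 2))
      ≡⟨ pos-* (c 2 ∸ 1) (c' 2 ∸ 2) ⟩
    + (c 2 ∸ 1) * + (c' 2 ∸ 2)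
      ≡⟨ cong₂ _*_ (+[m∸n]≡+m-+n 1≤c₂) (+[m∸n]≡+m-+n 2≤c'₂) ⟩
    (+ c 2 - + 1) * (+ c' 2 - + 2)
      ∎
    where
    xw = trans (sym (atDist-1 x w)) x∼w
    x≢y = atDist-≢ 0 {x} (eqB-refl x) xy
    w∈Y' = trans (adj⇒col-not xw) (cong not x∈Y)
    k'-def = deg' w w∈Y'
    c₂-def = c-def 1 x y x∈Y xy
    2≤k' = subst (2 ≤_) k'-def (count-≥2 (adj w) (trans (adj-sym w x) xw) wy x≢y)
    1≤c₂ = subst (1 ≤_) c₂-def (cNum-pos 1 {x} xy)
    counted : (k' ∸ 2) ℕ.* (γ 2 ∸ 1) ≡ (c 2 ∸ 1) ℕ.* (c' 2 ∸ 2)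
    counted = begin
      (k' ∸ 2) ℕ.* (γ 2 ∸ 1)
        ≡⟨ *-comm (k' ∸ 2) (γ 2 ∸ 1) ⟩
      (γ 2 ∸ 1) ℕ.* (k' ∸ 2)
        ≡⟨ cong (λ t → (γ 2 ∸ 1) ℕ.* (t ∸ 2)) k'-def ⟨
      (γ 2 ∸ 1) ℕ.* (degree G w ∸ 2)
        ≡⟨ common-neighbour-count xw wy x≢y (λ z → γ-def 2 x y z (s≤s z≤n) 2≤D-1 x∈Y xy)
                                            (λ u → c'-def 1 w u w∈Y') ⟩
      (c' 2 ∸ 2) ℕ.* (cNum G 2 x y ∸ 1)
        ≡⟨ cong (λ t → (c' 2 ∸ 2) ℕ.* (t ∸ 1)) c₂-def ⟩
      (c' 2 ∸ 2) ℕ.* (c 2 ∸ 1)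
        ≡⟨ *-comm (c' 2 ∸ 2) (c 2 ∸ 1) ⟩
      (c 2 ∸ 1) ℕ.* (c' 2 ∸ 2)
        ∎

  identity-geodesic : ∀ {b} (cᵇ : ℕ → ℕ) →
    (∀ i x z → col x ≡ b → atDist G (suc i) x z ≡ true → cNum G (suc i) x z ≡ cᵇ (suc i)) →
    ∀ j {z w} → col z ≡ b → atDist G (suc (suc j)) z w ≡ true → suc j ≤ D ∸ 1 →
    (∀ {x} → atDist G (suc j) z x ≡ true → col x ≡ true) →
    + γ (suc j) * (+ cᵇ (suc (suc j)) - + 1) ≡ + cᵇ (suc j) * (+ c' 2 - + 1)
  identity-geodesic cᵇ cᵇ-def j {z} {w} z∈b zw i≤D-1 Γᵢ⊆Y with atDist-pred (suc j) zw
  ... | x , zx , xw with atDist-pred j zx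
  ... | u , zu , ux = begin
    + γ i * (+ cᵇ (suc i) - + 1)
      ≡⟨ cong (+ γ i *_) (+[m∸n]≡+m-+n 1≤cᵢ₊₁) ⟨
    + γ i * + (cᵇ (suc i) ∸ 1)
      ≡⟨ pos-* (γ i) (cᵇ (suc i) ∸ 1) ⟨
    + (γ i ℕ.* (cᵇ (suc i) ∸ 1))
      ≡⟨ cong +_ counted ⟩
    + (cᵇ i ℕ.* (c' 2 ∸ 1))
      ≡⟨ pos-* (cᵇ i) (c' 2 ∸ 1) ⟩
    + cᵇ i * + (c' 2 ∸ 1)
      ≡⟨ cong (+ cᵇ i *_) (+[m∸n]≡+m-+n 1≤c'₂) ⟩
    + cᵇ i * (+ c' 2 - + 1)
      ∎
    where
    i = suc j
    x∈Y = Γᵢ⊆Y zx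
    w∈Y' = trans (adj⇒col-not xw) (cong not x∈Y)
    wu = atDist-2-across j zu (trans (adj-sym x u) ux) xw zw
    cᵢ₊₁-def = cᵇ-def i z w z∈b zw
    1≤cᵢ₊₁ = subst (1 ≤_) cᵢ₊₁-def (cNum-pos i zw)
    1≤c'₂ = subst (1 ≤_) (c'-def 1 w u w∈Y' wu) (cNum-pos 1 {w} wu)
    counted : γ i ℕ.* (cᵇ (suc i) ∸ 1) ≡ cᵇ i ℕ.* (c' 2 ∸ 1)
    counted = begin
      γ i ℕ.* (cᵇ (suc i) ∸ 1)
        ≡⟨ cong (λ t → γ i ℕ.* (t ∸ 1)) cᵢ₊₁-def ⟨
      γ i ℕ.* (cNum G (suc i) z w ∸ 1)
        ≡⟨ geodesic-count j zx xw zw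
             (λ y xy zy → γ-def i x y z (s≤s z≤n) i≤D-1 x∈Y xy (atDist-sym i zx) (atDist-sym i zy))
             (λ u → c'-def 1 w u w∈Y') ⟩
      (c' 2 ∸ 1) ℕ.* cNum G i z x
        ≡⟨ cong ((c' 2 ∸ 1) ℕ.*_) (cᵇ-def j z x z∈b zx) ⟩
      (c' 2 ∸ 1) ℕ.* cᵇ i
        ≡⟨ *-comm (c' 2 ∸ 1) (cᵇ i) ⟩
      cᵇ i ℕ.* (c' 2 ∸ 1)
        ∎

lemma3p1 : (G : Graph) (col : Fin (Graph.n G) → Bool) →
    DistanceBiregular G col →
    (D D' k k' : ℕ) (c c' γ : ℕ → ℕ) →
    (∀ x → col x ≡ true → Ecc G x D) →
    (∀ x → col x ≡ false → Ecc G x D') →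
    (∀ x → col x ≡ true → degree G x ≡ k) →
    (∀ x → col x ≡ false → degree G x ≡ k') →
    (∀ i x z → col x ≡ true → atDist G (suc i) x z ≡ true → cNum G (suc i) x z ≡ c (suc i)) →
    (∀ i x z → col x ≡ false → atDist G (suc i) x z ≡ true → cNum G (suc i) x z ≡ c' (suc i)) →
    (∀ i x y z → 1 ≤ i → i ≤ D ∸ 1 → col x ≡ true → atDist G 2 x y ≡ true →
      atDist G i x z ≡ true → atDist G i y z ≡ true →
      count G (λ w → atDist G (i ∸ 1) z w ∧ Graph.adj G x w ∧ Graph.adj G y w) ≡ γ i) →
    3 ≤ D →
    (i : ℕ) → 1 ≤ i → i ≤ (D ∸ 1) ⊓ (D' ∸ 1) →
    γ 2 ≢ 0 → γ i ≢ 0 →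
    ((2 ≤ c' 2 → (+ k' - + 2) * (+ γ 2 - + 1) ≡ (+ c 2 - + 1) * (+ c' 2 - + 2)) ×
     (2 ∣ i → + γ i * (+ c (suc i) - + 1) ≡ + c i * (+ c' 2 - + 1)) ×
     (¬ (2 ∣ i) → + γ i * (+ c' (suc i) - + 1) ≡ + c' i * (+ c' 2 - + 1)))
lemma3p1 G col DB D D' _ k' c c' γ ecc ecc' _ deg' c-def c'-def γ-def 3≤D (suc j) _ i≤D-1⊓D'-1 γ₂≢0 _
  with DistanceBiregular.Y-nonempty DB | DistanceBiregular.Y'-nonempty DB
... | x , x∈Y | x' , x'∈Y' =
  (λ 2≤c'₂ → identity-i x∈Y xy (∸-monoˡ-≤ 1 3≤D) deg' γ₂≢0 2≤c'₂) ,
  (λ 2∣i → identity-geodesic c c-def j x∈Y xw i≤D-1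
             (λ zv → trans (atDist-even-colour (suc j) 2∣i zv) x∈Y)) ,
  (λ 2∤i → identity-geodesic c' c'-def j x'∈Y' x'w' i≤D-1
             (λ zv → trans (¬-not (atDist-odd-colour (suc j) 2∤i zv)) (cong not x'∈Y')))
  where
  open TwoYHomogeneous G col DB D c c' γ c-def c'-def γ-def
  open Distance G using (Ecc⇒atDist)
  open Bipartite G col (DistanceBiregular.bipartite DB) using (atDist-even-colour; atDist-odd-colour)
  i≤D-1 = m≤n⊓o⇒m≤n (D ∸ 1) (D' ∸ 1) i≤D-1⊓D'-1
  i≤D'-1 = m≤n⊓o⇒m≤o (D ∸ 1) (D' ∸ 1) i≤D-1⊓D'-1
  xy = proj₂ (Ecc⇒atDist (ecc x x∈Y) (<⇒≤ 3≤D))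
  xw = proj₂ (Ecc⇒atDist (ecc x x∈Y) (m<n∸1⇒1+m<n D i≤D-1))
  x'w' = proj₂ (Ecc⇒atDist (ecc' x' x'∈Y') (m<n∸1⇒1+m<n D' i≤D'-1))
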